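{- Let $n\ge2$, let $\mathcal P=\mathbb Z_2^n\setminus\{\mathbf 0\}$, and for each $j\ge1$ let $\mathcal B_j$ be the family of all $j$-element subsets of $\mathcal P$ whose elements sum to zero. Let $3\le k\le n+1$, let $\mathbf e_1,\dots,\mathbf e_n$ be the canonical basis of $\mathbb Z_2^n$, and let $\mathfrak c_k=\{\mathbf e_1,\dots,\mathbf e_{k-1},\mathbf e_1+\mathbf e_2+\cdots+\mathbf e_{k-1}\}$. Then a block $\mathfrak b\in\mathcal B_k$ is irreducible if and only if $\mathfrak b$ lies in the orbit of $\mathfrak c_k$ under the natural action of $GL_n(2)$ on subsets of $\mathcal P$.
   Context: A block $\mathfrak b\in\mathcal B_k$ is called reducible if it is the union of two disjoint blocks $\mathfrak b_1\in\mathcal B_{k_1}$, $\mathfrak b_2\in\mathcal B_{k_2}$ with $k_1+k_2=k$; otherwise it is irreducible. -}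

module Defs where

open import Data.Bool using (Bool; true; false; _∧_; _∨_; _xor_; not; if_then_else_)
open import Data.Nat using (ℕ; zero; suc; _+_; _∸_; _≤_; _<ᵇ_)
open import Data.Fin using (Fin; toℕ; _≟_)
open import Data.Vec using (Vec; []; _∷_; replicate; zipWith; map; tabulate; foldr′; transpose)
open import Data.List using (List; [_]; _++_; filter; length)
open import Data.Bool.ListAction using (any)
import Data.List as L
open import Data.Fin.Base using ()
open import Data.Product using (Σ; ∃; _×_; _,_)
open import Relation.Nullary using (¬_; does)
open import Relation.Binary.PropositionalEquality using (_≡_)

Pt : ℕ → Set
Pt n = Vec Bool n

𝟎 : ∀ {n} → Pt n
𝟎 = replicate _ false

infixl 6 _⊕_
_⊕_ : ∀ {n} → Pt n → Pt n → Pt n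
_⊕_ = zipWith _xor_

_=ᵇ_ : Bool → Bool → Bool
true  =ᵇ b = b
false =ᵇ b = not b

eqPt : ∀ {n} → Pt n → Pt n → Bool
eqPt [] [] = true
eqPt (x ∷ xs) (y ∷ ys) = (x =ᵇ y) ∧ eqPt xs ys

allPts : (n : ℕ) → List (Pt n)
allPts zero = [ [] ]
allPts (suc n) = L.map (false ∷_) (allPts n) L.++ L.map (true ∷_) (allPts n)

Subset : ℕ → Set
Subset n = Pt n → Bool

elems : ∀ {n} → Subset n → List (Pt n)
elems {n} S = L.filter (λ x → S x Data.Bool.≟ true) (allPts n)
  where import Data.Bool

card : ∀ {n} → Subset n → ℕ
card S = length (elems S)

sumSet : ∀ {n} → Subset n → Pt n
sumSet S = L.foldr _⊕_ 𝟎 (elems S)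

InP : ∀ {n} → Subset n → Set
InP S = S 𝟎 ≡ false

Block : ∀ {n} → ℕ → Subset n → Set
Block j S = InP S × card S ≡ j × sumSet S ≡ 𝟎

-- Reducible block of B_k: disjoint union of blocks in B_{k1}, B_{k2}, k1+k2 = k
-- (blocks are only defined for j ≥ 1, so k1, k2 ≥ 1).
Reducible : ∀ {n} → ℕ → Subset n → Set
Reducible {n} k b =
  Σ ℕ λ k₁ → Σ ℕ λ k₂ → Σ (Subset n) λ b₁ → Σ (Subset n) λ b₂ →
    1 ≤ k₁ × 1 ≤ k₂ × k₁ + k₂ ≡ k ×
    Block k₁ b₁ × Block k₂ b₂ ×
    (∀ x → (b₁ x ∧ b₂ x) ≡ false) ×
    (∀ x → b x ≡ (b₁ x ∨ b₂ x))

Irreducible : ∀ {n} → ℕ → Subset n → Set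
Irreducible k b = ¬ Reducible k b

-- n×n matrices over Z_2 as vectors of rows
Mat : ℕ → Set
Mat n = Vec (Vec Bool n) n

dot : ∀ {n} → Pt n → Pt n → Bool
dot u v = foldr′ _xor_ false (zipWith _∧_ u v)

apply : ∀ {n} → Mat n → Pt n → Pt n
apply M x = map (λ row → dot row x) M

_·ₘ_ : ∀ {n} → Mat n → Mat n → Mat n
M ·ₘ N = map (λ row → map (λ col → dot row col) (transpose N)) M

idMat : ∀ {n} → Mat n
idMat {n} = tabulate λ i → tabulate λ j → does (i ≟ j)

IsInvertible : ∀ {n} → Mat n → Set
IsInvertible {n} M = Σ (Mat n) λ N → (M ·ₘ N ≡ idMat) × (N ·ₘ M ≡ idMat)

act : ∀ {n} → Mat n → Subset n → Subset n
act {n} g S y = any (λ x → S x ∧ eqPt (apply g x) y) (allPts n)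

InOrbit : ∀ {n} → Subset n → Subset n → Set
InOrbit {n} S T = Σ (Mat n) λ g → IsInvertible g × (∀ y → act g S y ≡ T y)

basis : ∀ {n} → Fin n → Pt n
basis i = tabulate λ j → does (i ≟ j)

cList : (n k : ℕ) → List (Pt n)
cList n k = L.map basis (L.filter (λ i → Data.Nat.Properties._<?_ (toℕ i) (k ∸ 1)) (L.allFin n))
            L.++ [ tabulate (λ j → toℕ j <ᵇ (k ∸ 1)) ]
  where import Data.Nat.Properties

cSet : (n k : ℕ) → Subset n
cSet n k y = any (eqPt y) (cList n k)

-- A block b ∈ B_k can be written as {v, w₁, …, w_{k-1}} with v = w₁ + ⋯ + w_{k-1}. If b is
-- irreducible, the wᵢ are linearly independent: a nonempty zero-sum set W of them would split b
-- into the blocks W and b ∖ W, the latter containing v. Independent vectors can be moved onto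
-- e₁, …, e_{k-1} one at a time by two transvections that fix the basis vectors already reached;
-- the resulting automorphism sends v to e₁ + ⋯ + e_{k-1}, i.e. b onto cₖ. Conversely, automorphisms
-- transport splittings of blocks, and cₖ has no splitting: coordinate i < k - 1 of a zero-sum
-- subset of cₖ forces eᵢ and e₁ + ⋯ + e_{k-1} to be both in it or both out of it.

module Submission where

open import Defs
open import Algebra.Bundles using (CommutativeRing)
open import Data.Bool as Bool using (Bool; true; false; _∧_; _∨_; _xor_; not)
import Data.Bool.Properties as Boolₚ
open import Data.Bool.ListAction using (any)
open import Data.Fin as Fin using (Fin; toℕ)
import Data.Fin.Properties as Finₚ
open import Data.Nat as ℕ using (ℕ; zero; suc; _≤_; _<_; _∸_; _<ᵇ_; z≤n; s≤s)
import Data.Nat.Properties as ℕₚ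
open import Data.List as List using (List; []; _∷_; _++_; length; [_])
open import Data.List.Membership.Propositional using (_∈_; _∉_; find; lose)
import Data.List.Membership.Propositional.Properties as ∈ₚ
open import Data.List.Relation.Unary.Any using (here; there)
import Data.List.Relation.Unary.All as All
open import Data.List.Relation.Unary.AllPairs using ([]; _∷_)
open import Data.List.Relation.Unary.Unique.Propositional using (Unique)
import Data.List.Relation.Unary.Unique.Propositional.Properties as Uniqueₚ
import Data.List.Relation.Unary.All.Properties as Allₚ
open import Data.List.Relation.Binary.Permutation.Propositional
  using (_↭_; ↭-sym; ↭-trans; ↭-reflexive; prep; swap; module PermutationReasoning)
import Data.List.Relation.Binary.Permutation.Propositional.Properties as ↭ₚ
open import Data.List.Relation.Binary.BagAndSetEquality using (∼bag⇒↭)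
open import Data.List.Membership.Propositional.Properties.WithK using (unique∧set⇒bag)
import Data.List.Properties as Listₚ
import Data.List.Relation.Unary.Any.Properties as Anyₚ
open import Data.Product using (Σ; ∃; _×_; _,_; proj₁; proj₂)
open import Function.Bundles using (mk⇔; Equivalence)
open import Data.Vec as Vec using (Vec; []; _∷_; lookup; tabulate; transpose)
import Data.Vec.Properties as Vecₚ
open import Function using (_∘_; id)
open import Data.Empty using (⊥; ⊥-elim)
open import Data.Sum using (inj₁; inj₂)
open import Relation.Nullary using (¬_; yes; no; does; contradiction; _×-dec_)
open import Relation.Nullary.Decidable using (dec-true; dec-false)
open import Relation.Binary.PropositionalEquality hiding ([_])

open import Algebra.Properties.CommutativeSemigroup
  (CommutativeRing.+-commutativeSemigroup Boolₚ.xor-∧-commutativeRing)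
  using () renaming (interchange to xor-interchange)

private variable
  n k : ℕ
  S S′ : Subset n

-- The vector space ℤ₂ⁿ

⊕-assoc : (x y z : Pt n) → (x ⊕ y) ⊕ z ≡ x ⊕ (y ⊕ z)
⊕-assoc = Vecₚ.zipWith-assoc Boolₚ.xor-assoc

⊕-comm : (x y : Pt n) → x ⊕ y ≡ y ⊕ x
⊕-comm = Vecₚ.zipWith-comm Boolₚ.xor-comm

⊕-identityˡ : (x : Pt n) → 𝟎 ⊕ x ≡ x
⊕-identityˡ = Vecₚ.zipWith-identityˡ Boolₚ.xor-identityˡ

⊕-identityʳ : (x : Pt n) → x ⊕ 𝟎 ≡ x
⊕-identityʳ = Vecₚ.zipWith-identityʳ Boolₚ.xor-identityʳ

⊕-same : (x : Pt n) → x ⊕ x ≡ 𝟎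
⊕-same []      = refl
⊕-same (a ∷ x) = cong₂ _∷_ (Boolₚ.xor-same a) (⊕-same x)

⊕-interchange : (w x y z : Pt n) → (w ⊕ x) ⊕ (y ⊕ z) ≡ (w ⊕ y) ⊕ (x ⊕ z)
⊕-interchange []      []      []      []      = refl
⊕-interchange (a ∷ w) (b ∷ x) (c ∷ y) (d ∷ z) =
  cong₂ _∷_ (xor-interchange a b c d) (⊕-interchange w x y z)

⊕≡𝟎⇒≡ : {x y : Pt n} → x ⊕ y ≡ 𝟎 → x ≡ y
⊕≡𝟎⇒≡ {x = x} {y} x⊕y≡𝟎 = begin
  x            ≡⟨ sym (⊕-identityʳ x) ⟩
  x ⊕ 𝟎        ≡⟨ cong (x ⊕_) (sym (⊕-same y)) ⟩
  x ⊕ (y ⊕ y)  ≡⟨ sym (⊕-assoc x y y) ⟩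
  (x ⊕ y) ⊕ y  ≡⟨ cong (_⊕ y) x⊕y≡𝟎 ⟩
  𝟎 ⊕ y        ≡⟨ ⊕-identityˡ y ⟩
  y            ∎
  where open ≡-Reasoning

lookup-⊕ : (x y : Pt n) (i : Fin n) → lookup (x ⊕ y) i ≡ lookup x i xor lookup y i
lookup-⊕ x y i = Vecₚ.lookup-zipWith _xor_ i x y

lookup-𝟎 : (i : Fin n) → lookup (𝟎 {n}) i ≡ false
lookup-𝟎 i = Vecₚ.lookup-replicate i false

lookup-ext : {A : Set} {x y : Vec A n} → (∀ i → lookup x i ≡ lookup y i) → x ≡ y
lookup-ext {x = x} {y} eq =
  trans (sym (Vecₚ.tabulate∘lookup x)) (trans (Vecₚ.tabulate-cong eq) (Vecₚ.tabulate∘lookup y))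

lookup-basis : (i j : Fin n) → lookup (basis i) j ≡ does (i Fin.≟ j)
lookup-basis i j = Vecₚ.lookup∘tabulate _ j

lookup-basis-same : (i : Fin n) → lookup (basis i) i ≡ true
lookup-basis-same i = trans (lookup-basis i i) (dec-true (i Fin.≟ i) refl)

lookup-basis-other : {i j : Fin n} → i ≢ j → lookup (basis i) j ≡ false
lookup-basis-other {i = i} {j} i≢j = trans (lookup-basis i j) (dec-false (i Fin.≟ j) i≢j)

lookup-basis-true : {i j : Fin n} → lookup (basis i) j ≡ true → i ≡ j
lookup-basis-true {i = i} {j} eᵢⱼ with i Fin.≟ j
... | yes i≡j = i≡j
... | no  i≢j with () ← trans (sym eᵢⱼ) (lookup-basis-other i≢j)

basis-injective : {i j : Fin n} → basis i ≡ basis j → i ≡ j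
basis-injective {i = i} eᵢ≡eⱼ =
  sym (lookup-basis-true (trans (cong (λ v → lookup v i) (sym eᵢ≡eⱼ)) (lookup-basis-same i)))

basis-zero : basis (Fin.zero {n}) ≡ true ∷ 𝟎
basis-zero = cong (true ∷_) (lookup-ext λ i → trans (Vecₚ.lookup∘tabulate _ i) (sym (lookup-𝟎 i)))

-- Linear maps and matrices

LinearFunctional : (Pt n → Bool) → Set
LinearFunctional φ = ∀ x y → φ (x ⊕ y) ≡ φ x xor φ y

Linear : (Pt n → Pt n) → Set
Linear f = ∀ x y → f (x ⊕ y) ≡ f x ⊕ f y

linearFunctional-𝟎 : (φ : Pt n → Bool) → LinearFunctional φ → φ 𝟎 ≡ false
linearFunctional-𝟎 φ φ-lin =
  trans (cong φ (sym (⊕-same 𝟎))) (trans (φ-lin 𝟎 𝟎) (Boolₚ.xor-same (φ 𝟎)))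

linear-𝟎 : (f : Pt n → Pt n) → Linear f → f 𝟎 ≡ 𝟎
linear-𝟎 f f-lin = trans (cong f (sym (⊕-same 𝟎))) (trans (f-lin 𝟎 𝟎) (⊕-same (f 𝟎)))

lookup-linear : {f : Pt n → Pt n} → Linear f → (i : Fin n) → LinearFunctional (λ x → lookup (f x) i)
lookup-linear {f = f} f-lin i x y = trans (cong (λ v → lookup v i) (f-lin x y)) (lookup-⊕ (f x) (f y) i)

dot-comm : (r x : Pt n) → dot r x ≡ dot x r
dot-comm []      []      = refl
dot-comm (a ∷ r) (b ∷ x) = cong₂ _xor_ (Boolₚ.∧-comm a b) (dot-comm r x)

dot-𝟎ʳ : (r : Pt n) → dot r 𝟎 ≡ false
dot-𝟎ʳ []      = refl
dot-𝟎ʳ (a ∷ r) = cong₂ _xor_ (Boolₚ.∧-zeroʳ a) (dot-𝟎ʳ r)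

dot-linear : (r : Pt n) → LinearFunctional (dot r)
dot-linear []      []      []      = refl
dot-linear (a ∷ r) (b ∷ x) (c ∷ y) =
  trans (cong₂ _xor_ (Boolₚ.∧-distribˡ-xor a b c) (dot-linear r x y))
        (xor-interchange (a ∧ b) (a ∧ c) (dot r x) (dot r y))

dot-basisʳ : (r : Pt n) (j : Fin n) → dot r (basis j) ≡ lookup r j
dot-basisʳ (a ∷ r) Fin.zero    =
  trans (cong₂ _xor_ (Boolₚ.∧-identityʳ a) (trans (cong (dot r ∘ Vec.tail) basis-zero) (dot-𝟎ʳ r)))
        (Boolₚ.xor-identityʳ a)
dot-basisʳ (a ∷ r) (Fin.suc j) = cong₂ _xor_ (Boolₚ.∧-zeroʳ a) (dot-basisʳ r j)

linearFunctional⇒dot : (φ : Pt n → Bool) → LinearFunctional φ →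
                       ∀ x → φ x ≡ dot (tabulate (φ ∘ basis)) x
linearFunctional⇒dot φ φ-lin []      = linearFunctional-𝟎 φ φ-lin
linearFunctional⇒dot φ φ-lin (a ∷ x) = begin
  φ (a ∷ x)                    ≡⟨ cong φ split ⟩
  φ ((a ∷ 𝟎) ⊕ (false ∷ x))    ≡⟨ φ-lin (a ∷ 𝟎) (false ∷ x) ⟩
  φ (a ∷ 𝟎) xor φ (false ∷ x)  ≡⟨ cong₂ _xor_ (head-part a) (linearFunctional⇒dot (φ ∘ (false ∷_)) tail-lin x) ⟩
  dot (tabulate (φ ∘ basis)) (a ∷ x) ∎
  where
  open ≡-Reasoning
  split : a ∷ x ≡ (a ∷ 𝟎) ⊕ (false ∷ x)
  split = cong₂ _∷_ (sym (Boolₚ.xor-identityʳ a)) (sym (⊕-identityˡ x))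
  tail-lin : LinearFunctional (φ ∘ (false ∷_))
  tail-lin y z = φ-lin (false ∷ y) (false ∷ z)
  head-part : ∀ a → φ (a ∷ 𝟎) ≡ φ (basis Fin.zero) ∧ a
  head-part false = trans (linearFunctional-𝟎 φ φ-lin) (sym (Boolₚ.∧-zeroʳ _))
  head-part true  = trans (cong φ (sym basis-zero)) (sym (Boolₚ.∧-identityʳ _))

linearFunctional-ext : (φ ψ : Pt n → Bool) → LinearFunctional φ → LinearFunctional ψ →
                       (∀ j → φ (basis j) ≡ ψ (basis j)) → ∀ x → φ x ≡ ψ x
linearFunctional-ext φ ψ φ-lin ψ-lin eq x =
  trans (linearFunctional⇒dot φ φ-lin x)
        (trans (cong (λ r → dot r x) (Vecₚ.tabulate-cong eq)) (sym (linearFunctional⇒dot ψ ψ-lin x)))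

lookup-apply : (M : Mat n) (x : Pt n) (i : Fin n) → lookup (apply M x) i ≡ dot (lookup M i) x
lookup-apply M x i = Vecₚ.lookup-map i _ M

apply-linear : (M : Mat n) → Linear (apply M)
apply-linear M x y = lookup-ext λ i → begin
  lookup (apply M (x ⊕ y)) i                    ≡⟨ lookup-apply M (x ⊕ y) i ⟩
  dot (lookup M i) (x ⊕ y)                      ≡⟨ dot-linear (lookup M i) x y ⟩
  dot (lookup M i) x xor dot (lookup M i) y     ≡⟨ sym (cong₂ _xor_ (lookup-apply M x i) (lookup-apply M y i)) ⟩
  lookup (apply M x) i xor lookup (apply M y) i ≡⟨ sym (lookup-⊕ (apply M x) (apply M y) i) ⟩
  lookup (apply M x ⊕ apply M y) i              ∎
  where open ≡-Reasoning

matrix : (Pt n → Pt n) → Mat n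
matrix f = tabulate λ i → tabulate λ j → lookup (f (basis j)) i

apply-matrix : {f : Pt n → Pt n} → Linear f → ∀ x → apply (matrix f) x ≡ f x
apply-matrix {f = f} f-lin x = lookup-ext λ i → begin
  lookup (apply (matrix f) x) i                 ≡⟨ lookup-apply (matrix f) x i ⟩
  dot (lookup (matrix f) i) x                   ≡⟨ cong (λ r → dot r x) (Vecₚ.lookup∘tabulate _ i) ⟩
  dot (tabulate λ j → lookup (f (basis j)) i) x ≡⟨ sym (linearFunctional⇒dot _ (lookup-linear f-lin i) x) ⟩
  lookup (f x) i                                ∎
  where open ≡-Reasoning

Mat-ext : (M N : Mat n) → (∀ x → apply M x ≡ apply N x) → M ≡ N
Mat-ext M N eq = lookup-ext λ i → lookup-ext λ j → begin
  lookup (lookup M i) j          ≡⟨ sym (dot-basisʳ (lookup M i) j) ⟩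
  dot (lookup M i) (basis j)     ≡⟨ sym (lookup-apply M (basis j) i) ⟩
  lookup (apply M (basis j)) i   ≡⟨ cong (λ v → lookup v i) (eq (basis j)) ⟩
  lookup (apply N (basis j)) i   ≡⟨ lookup-apply N (basis j) i ⟩
  dot (lookup N i) (basis j)     ≡⟨ dot-basisʳ (lookup N i) j ⟩
  lookup (lookup N i) j          ∎
  where open ≡-Reasoning

lookup-transpose : {A : Set} {m : ℕ} (N : Vec (Vec A n) m) (j : Fin n) →
                   lookup (transpose N) j ≡ Vec.map (λ r → lookup r j) N
lookup-transpose []        j = Vecₚ.lookup-replicate j []
lookup-transpose (r ∷ rs) j = begin
  lookup ((Vec.replicate _ Vec._∷_ Vec.⊛ r) Vec.⊛ transpose rs) j
    ≡⟨ Vecₚ.lookup-⊛ j (Vec.replicate _ Vec._∷_ Vec.⊛ r) (transpose rs) ⟩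
  lookup (Vec.replicate _ Vec._∷_ Vec.⊛ r) j (lookup (transpose rs) j)
    ≡⟨ cong₂ (λ f z → f z) head (lookup-transpose rs j) ⟩
  lookup r j ∷ Vec.map (λ r → lookup r j) rs ∎
  where
  open ≡-Reasoning
  head : lookup (Vec.replicate _ Vec._∷_ Vec.⊛ r) j ≡ lookup r j Vec.∷_
  head = trans (Vecₚ.lookup-⊛ j (Vec.replicate _ Vec._∷_) r)
               (cong (λ g → g (lookup r j)) (Vecₚ.lookup-replicate j Vec._∷_))

dot-row-· : (r : Pt n) (N : Mat n) (x : Pt n) →
            dot (Vec.map (dot r) (transpose N)) x ≡ dot r (apply N x)
dot-row-· r N = linearFunctional-ext _ _ (dot-linear (Vec.map (dot r) (transpose N))) right-linear on-basis
  where
  open ≡-Reasoning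
  right-linear : LinearFunctional (λ y → dot r (apply N y))
  right-linear y z = trans (cong (dot r) (apply-linear N y z)) (dot-linear r (apply N y) (apply N z))
  on-basis : ∀ j → dot (Vec.map (dot r) (transpose N)) (basis j) ≡ dot r (apply N (basis j))
  on-basis j = begin
    dot (Vec.map (dot r) (transpose N)) (basis j) ≡⟨ dot-basisʳ (Vec.map (dot r) (transpose N)) j ⟩
    lookup (Vec.map (dot r) (transpose N)) j      ≡⟨ Vecₚ.lookup-map j _ (transpose N) ⟩
    dot r (lookup (transpose N) j)                ≡⟨ cong (dot r) (lookup-transpose N j) ⟩
    dot r (Vec.map (λ row → lookup row j) N)
      ≡⟨ cong (dot r) (Vecₚ.map-cong (λ row → sym (dot-basisʳ row j)) N) ⟩
    dot r (apply N (basis j))                     ∎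

apply-· : (M N : Mat n) (x : Pt n) → apply (M ·ₘ N) x ≡ apply M (apply N x)
apply-· M N x = lookup-ext λ i → begin
  lookup (apply (M ·ₘ N) x) i                          ≡⟨ lookup-apply (M ·ₘ N) x i ⟩
  dot (lookup (M ·ₘ N) i) x                            ≡⟨ cong (λ r → dot r x) (Vecₚ.lookup-map i _ M) ⟩
  dot (Vec.map (dot (lookup M i)) (transpose N)) x     ≡⟨ dot-row-· (lookup M i) N x ⟩
  dot (lookup M i) (apply N x)                         ≡⟨ sym (lookup-apply M (apply N x) i) ⟩
  lookup (apply M (apply N x)) i                       ∎
  where open ≡-Reasoning

apply-idMat : (x : Pt n) → apply idMat x ≡ x
apply-idMat x = lookup-ext λ i → begin
  lookup (apply idMat x) i   ≡⟨ lookup-apply idMat x i ⟩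
  dot (lookup idMat i) x     ≡⟨ cong (λ r → dot r x) (Vecₚ.lookup∘tabulate _ i) ⟩
  dot (basis i) x            ≡⟨ dot-comm (basis i) x ⟩
  dot x (basis i)            ≡⟨ dot-basisʳ x i ⟩
  lookup x i                 ∎
  where open ≡-Reasoning

-- Automorphisms and the action of GL_n(2) on subsets

eqPt-refl : (x : Pt n) → eqPt x x ≡ true
eqPt-refl []          = refl
eqPt-refl (true ∷ x)  = eqPt-refl x
eqPt-refl (false ∷ x) = eqPt-refl x

eqPt-sound : (x y : Pt n) → eqPt x y ≡ true → x ≡ y
eqPt-sound []          []          _  = refl
eqPt-sound (true ∷ x)  (true ∷ y)  eq = cong (true ∷_) (eqPt-sound x y eq)
eqPt-sound (false ∷ x) (false ∷ y) eq = cong (false ∷_) (eqPt-sound x y eq)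

any-true⁻ : {A : Set} (p : A → Bool) (xs : List A) → any p xs ≡ true → ∃ λ x → x ∈ xs × p x ≡ true
any-true⁻ p xs eq with x , x∈xs , px ← find (Anyₚ.any⁻ p xs (Equivalence.from Boolₚ.T-≡ eq)) =
  x , x∈xs , Equivalence.to Boolₚ.T-≡ px

any-true⁺ : {A : Set} (p : A → Bool) {x : A} {xs : List A} → x ∈ xs → p x ≡ true → any p xs ≡ true
any-true⁺ p x∈xs px = Equivalence.to Boolₚ.T-≡ (Anyₚ.any⁺ p (lose x∈xs (Equivalence.from Boolₚ.T-≡ px)))

allPts-complete : (x : Pt n) → x ∈ allPts n
allPts-complete []          = here refl
allPts-complete (false ∷ x) = ∈ₚ.∈-++⁺ˡ (∈ₚ.∈-map⁺ (false ∷_) (allPts-complete x))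
allPts-complete (true ∷ x)  = ∈ₚ.∈-++⁺ʳ _ (∈ₚ.∈-map⁺ (true ∷_) (allPts-complete x))

≡true-ext : {a b : Bool} → (a ≡ true → b ≡ true) → (b ≡ true → a ≡ true) → a ≡ b
≡true-ext a⇒b b⇒a = Boolₚ.⇔→≡ {z = true} (mk⇔ a⇒b b⇒a)

record Aut (n : ℕ) : Set where
  field
    to from   : Pt n → Pt n
    to-linear : Linear to
    from∘to   : ∀ x → from (to x) ≡ x
    to∘from   : ∀ x → to (from x) ≡ x

  to-injective : ∀ {x y} → to x ≡ to y → x ≡ y
  to-injective {x} {y} eq = trans (sym (from∘to x)) (trans (cong from eq) (from∘to y))

  from-injective : ∀ {x y} → from x ≡ from y → x ≡ y
  from-injective {x} {y} eq = trans (sym (to∘from x)) (trans (cong to eq) (to∘from y))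

  from-linear : Linear from
  from-linear x y = to-injective (begin
    to (from (x ⊕ y))             ≡⟨ to∘from (x ⊕ y) ⟩
    x ⊕ y                         ≡⟨ sym (cong₂ _⊕_ (to∘from x) (to∘from y)) ⟩
    to (from x) ⊕ to (from y)     ≡⟨ sym (to-linear (from x) (from y)) ⟩
    to (from x ⊕ from y)          ∎)
    where open ≡-Reasoning

open Aut

idᴬ : Aut n
idᴬ = record { to = id ; from = id ; to-linear = λ _ _ → refl ; from∘to = λ _ → refl ; to∘from = λ _ → refl }

_∘ᴬ_ : Aut n → Aut n → Aut n
B ∘ᴬ A = record
  { to        = to B ∘ to A
  ; from      = from A ∘ from B
  ; to-linear = λ x y → trans (cong (to B) (to-linear A x y)) (to-linear B _ _)
  ; from∘to   = λ x → trans (cong (from A) (from∘to B _)) (from∘to A x)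
  ; to∘from   = λ x → trans (cong (to B) (to∘from A _)) (to∘from B x)
  }

_⁻¹ᴬ : Aut n → Aut n
A ⁻¹ᴬ = record
  { to = from A ; from = to A ; to-linear = from-linear A ; from∘to = to∘from A ; to∘from = from∘to A }

apply-cancel : (M M′ : Mat n) → M ·ₘ M′ ≡ idMat → ∀ x → apply M (apply M′ x) ≡ x
apply-cancel M M′ eq x = trans (sym (apply-· M M′ x)) (trans (cong (λ K → apply K x) eq) (apply-idMat x))

act-invertible : (g N : Mat n) → g ·ₘ N ≡ idMat → N ·ₘ g ≡ idMat →
                 (S : Subset n) (y : Pt n) → act g S y ≡ S (apply N y)
act-invertible {n} g N gN≡id Ng≡id S y = ≡true-ext act⇒ ⇒act
  where
  act⇒ : act g S y ≡ true → S (apply N y) ≡ true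
  act⇒ eq with x , _ , Sx∧gx≡y ← any-true⁻ (λ x → S x ∧ eqPt (apply g x) y) (allPts n) eq
          with S x in Sx
  ... | true = subst (λ z → S z ≡ true) (trans (sym (apply-cancel N g Ng≡id x)) (cong (apply N) (eqPt-sound _ _ Sx∧gx≡y))) Sx
  ⇒act : S (apply N y) ≡ true → act g S y ≡ true
  ⇒act SNy = any-true⁺ (λ x → S x ∧ eqPt (apply g x) y) (allPts-complete (apply N y))
    (trans (cong₂ _∧_ SNy (cong (λ z → eqPt z y) (apply-cancel g N gN≡id y))) (eqPt-refl y))

inOrbit⇒aut : {S T : Subset n} → InOrbit S T → Σ (Aut n) λ A → ∀ y → T y ≡ S (from A y)
inOrbit⇒aut {S = S} (g , (N , gN≡id , Ng≡id) , act≡) =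
  A , λ y → trans (sym (act≡ y)) (act-invertible g N gN≡id Ng≡id S y)
  where
  A : Aut _
  A = record
    { to = apply g ; from = apply N ; to-linear = apply-linear g
    ; from∘to = apply-cancel N g Ng≡id ; to∘from = apply-cancel g N gN≡id }

·ₘ-inverse : (M M′ : Mat n) {f f′ : Pt n → Pt n} →
             (∀ x → apply M x ≡ f x) → (∀ x → apply M′ x ≡ f′ x) → (∀ x → f (f′ x) ≡ x) →
             M ·ₘ M′ ≡ idMat
·ₘ-inverse M M′ {f} {f′} M≗f M′≗f′ f∘f′≗id = Mat-ext (M ·ₘ M′) idMat λ x → begin
  apply (M ·ₘ M′) x     ≡⟨ apply-· M M′ x ⟩
  apply M (apply M′ x)  ≡⟨ M≗f _ ⟩
  f (apply M′ x)        ≡⟨ cong f (M′≗f′ x) ⟩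
  f (f′ x)              ≡⟨ f∘f′≗id x ⟩
  x                     ≡⟨ sym (apply-idMat x) ⟩
  apply idMat x         ∎
  where open ≡-Reasoning

aut⇒inOrbit : {S T : Subset n} (A : Aut n) → (∀ y → T y ≡ S (from A y)) → InOrbit S T
aut⇒inOrbit {S = S} A T≡ = g , (N , gN≡id , Ng≡id) , λ y →
  trans (act-invertible g N gN≡id Ng≡id S y) (trans (cong S (apply-N y)) (sym (T≡ y)))
  where
  g N : Mat _
  g = matrix (to A)
  N = matrix (from A)
  apply-g : ∀ x → apply g x ≡ to A x
  apply-g = apply-matrix (to-linear A)
  apply-N : ∀ x → apply N x ≡ from A x
  apply-N = apply-matrix (from-linear A)
  gN≡id : g ·ₘ N ≡ idMat
  gN≡id = ·ₘ-inverse g N apply-g apply-N (to∘from A)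
  Ng≡id : N ·ₘ g ≡ idMat
  Ng≡id = ·ₘ-inverse N g apply-N apply-g (from∘to A)

-- Finite subsets and their sums

select : {A : Set} → (A → Bool) → List A → List A
select p = List.filter (λ x → p x Bool.≟ true)

module _ {A : Set} (p : A → Bool) where

  ∈-select⁺ : {x : A} {xs : List A} → x ∈ xs → p x ≡ true → x ∈ select p xs
  ∈-select⁺ = ∈ₚ.∈-filter⁺ (λ x → p x Bool.≟ true)

  ∈-select⁻ : {x : A} {xs : List A} → x ∈ select p xs → x ∈ xs × p x ≡ true
  ∈-select⁻ = ∈ₚ.∈-filter⁻ (λ x → p x Bool.≟ true)

  select-unique : {xs : List A} → Unique xs → Unique (select p xs)
  select-unique = Uniqueₚ.filter⁺ (λ x → p x Bool.≟ true)

  select-↭ : {xs ys : List A} → xs ↭ ys → select p xs ↭ select p ys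
  select-↭ = ↭ₚ.filter-↭ (λ x → p x Bool.≟ true)

  select-++ : (xs ys : List A) → select p (xs ++ ys) ≡ select p xs ++ select p ys
  select-++ = Listₚ.filter-++ (λ x → p x Bool.≟ true)

select-map : {A B : Set} (p : B → Bool) (f : A → B) (xs : List A) →
             select p (List.map f xs) ≡ List.map f (select (p ∘ f) xs)
select-map p f []       = refl
select-map p f (x ∷ xs) with p (f x)
... | true  = cong (f x ∷_) (select-map p f xs)
... | false = select-map p f xs

↭-of-same-members : {A : Set} {xs ys : List A} → Unique xs → Unique ys →
                    (∀ {x} → x ∈ xs → x ∈ ys) → (∀ {x} → x ∈ ys → x ∈ xs) → xs ↭ ys
↭-of-same-members xs! ys! xs⊆ys ys⊆xs = ∼bag⇒↭ (unique∧set⇒bag xs! ys! (mk⇔ xs⊆ys ys⊆xs))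

∑ : List (Pt n) → Pt n
∑ = List.foldr _⊕_ 𝟎

∑-++ : (xs ys : List (Pt n)) → ∑ (xs ++ ys) ≡ ∑ xs ⊕ ∑ ys
∑-++ []       ys = sym (⊕-identityˡ (∑ ys))
∑-++ (x ∷ xs) ys = trans (cong (x ⊕_) (∑-++ xs ys)) (sym (⊕-assoc x (∑ xs) (∑ ys)))

∑-↭ : {xs ys : List (Pt n)} → xs ↭ ys → ∑ xs ≡ ∑ ys
∑-↭ _↭_.refl                                 = refl
∑-↭ (prep x xs↭ys)                           = cong (x ⊕_) (∑-↭ xs↭ys)
∑-↭ {xs = _ ∷ _ ∷ xs} {_ ∷ _ ∷ ys} (swap x y xs↭ys) = begin
  x ⊕ (y ⊕ ∑ xs)  ≡⟨ sym (⊕-assoc x y (∑ xs)) ⟩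
  (x ⊕ y) ⊕ ∑ xs  ≡⟨ cong₂ _⊕_ (⊕-comm x y) (∑-↭ xs↭ys) ⟩
  (y ⊕ x) ⊕ ∑ ys  ≡⟨ ⊕-assoc y x (∑ ys) ⟩
  y ⊕ (x ⊕ ∑ ys)  ∎
  where open ≡-Reasoning
∑-↭ (_↭_.trans xs↭ys ys↭zs)                 = trans (∑-↭ xs↭ys) (∑-↭ ys↭zs)

∑-map : (f : Pt n → Pt n) → Linear f → (xs : List (Pt n)) → ∑ (List.map f xs) ≡ f (∑ xs)
∑-map f f-lin []       = sym (linear-𝟎 f f-lin)
∑-map f f-lin (x ∷ xs) = trans (cong (f x ⊕_) (∑-map f f-lin xs)) (sym (f-lin x (∑ xs)))

infix 4 _∈ˢ_ _⊆_

_∈ˢ_ : Pt n → Subset n → Set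
x ∈ˢ S = S x ≡ true

_⊆_ : Subset n → Subset n → Set
S ⊆ T = ∀ {x} → x ∈ˢ S → x ∈ˢ T

-- `cSet n k` is definitionally `⟦ cList n k ⟧`.
⟦_⟧ : List (Pt n) → Subset n
⟦ xs ⟧ y = any (eqPt y) xs

∈ˢ⟦⟧⁺ : (xs : List (Pt n)) {x : Pt n} → x ∈ xs → x ∈ˢ ⟦ xs ⟧
∈ˢ⟦⟧⁺ xs {x} x∈xs = any-true⁺ (eqPt x) x∈xs (eqPt-refl x)

∈ˢ⟦⟧⁻ : (xs : List (Pt n)) {x : Pt n} → x ∈ˢ ⟦ xs ⟧ → x ∈ xs
∈ˢ⟦⟧⁻ xs {x} x∈⟦xs⟧ with y , y∈xs , x≈y ← any-true⁻ (eqPt x) xs x∈⟦xs⟧ =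
  subst (_∈ xs) (sym (eqPt-sound x y x≈y)) y∈xs

allPts-unique : (n : ℕ) → Unique (allPts n)
allPts-unique zero    = All.[] ∷ []
allPts-unique (suc n) = Uniqueₚ.++⁺ (Uniqueₚ.map⁺ Vecₚ.∷-injectiveʳ (allPts-unique n))
                                    (Uniqueₚ.map⁺ Vecₚ.∷-injectiveʳ (allPts-unique n))
                                    heads-differ
  where
  heads-differ : ∀ {v} → v ∈ List.map (false ∷_) (allPts n) × v ∈ List.map (true ∷_) (allPts n) → ⊥
  heads-differ (v∈₀ , v∈₁) with _ , _ , refl ← ∈ₚ.∈-map⁻ (false ∷_) v∈₀
                           with _ , _ , () ← ∈ₚ.∈-map⁻ (true ∷_) v∈₁

∈-elems⁺ : (S : Subset n) {x : Pt n} → x ∈ˢ S → x ∈ elems S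
∈-elems⁺ S {x} x∈S = ∈-select⁺ S (allPts-complete x) x∈S

∈-elems⁻ : (S : Subset n) {x : Pt n} → x ∈ elems S → x ∈ˢ S
∈-elems⁻ {n} S x∈ = proj₂ (∈-select⁻ S {xs = allPts n} x∈)

elems-unique : (S : Subset n) → Unique (elems S)
elems-unique {n} S = select-unique S (allPts-unique n)

elems-↭ : {xs : List (Pt n)} → Unique xs →
          (∀ {x} → x ∈ˢ S → x ∈ xs) → (∀ {x} → x ∈ xs → x ∈ˢ S) → elems S ↭ xs
elems-↭ {S = S} xs! S⊆xs xs⊆S =
  ↭-of-same-members (elems-unique S) xs! (S⊆xs ∘ ∈-elems⁻ S) (∈-elems⁺ S ∘ xs⊆S)

elems-⟦⟧ : {xs : List (Pt n)} → Unique xs → elems ⟦ xs ⟧ ↭ xs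
elems-⟦⟧ {xs = xs} xs! = elems-↭ xs! (∈ˢ⟦⟧⁻ xs) (∈ˢ⟦⟧⁺ xs)

elems-restrict : {xs : List (Pt n)} → Unique xs → S ⊆ ⟦ xs ⟧ → elems S ↭ select S xs
elems-restrict {S = S} {xs} xs! S⊆xs =
  elems-↭ (select-unique S xs!) (λ x∈S → ∈-select⁺ S (∈ˢ⟦⟧⁻ xs (S⊆xs x∈S)) x∈S)
          (proj₂ ∘ ∈-select⁻ S {xs = xs})

elems-∪ : (S₁ S₂ : Subset n) → (∀ x → S x ≡ S₁ x ∨ S₂ x) → (∀ x → S₁ x ∧ S₂ x ≡ false) →
          elems S ↭ elems S₁ ++ elems S₂
elems-∪ {S = S} S₁ S₂ S≡∪ disjoint =
  elems-↭ (Uniqueₚ.++⁺ (elems-unique S₁) (elems-unique S₂) disjoint′) S⇒∪ ∪⇒S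
  where
  disjoint′ : ∀ {x} → x ∈ elems S₁ × x ∈ elems S₂ → ⊥
  disjoint′ {x} (x∈₁ , x∈₂)
    with () ← trans (sym (cong₂ _∧_ (∈-elems⁻ S₁ x∈₁) (∈-elems⁻ S₂ x∈₂))) (disjoint x)
  S⇒∪ : ∀ {x} → x ∈ˢ S → x ∈ elems S₁ ++ elems S₂
  S⇒∪ {x} x∈S with S₁ x in x∈S₁ | S₂ x in x∈S₂ | trans (sym x∈S) (S≡∪ x)
  ... | true  | _    | _ = ∈ₚ.∈-++⁺ˡ (∈-elems⁺ S₁ x∈S₁)
  ... | false | true | _ = ∈ₚ.∈-++⁺ʳ (elems S₁) (∈-elems⁺ S₂ x∈S₂)
  ∪⇒S : ∀ {x} → x ∈ elems S₁ ++ elems S₂ → x ∈ˢ S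
  ∪⇒S {x} x∈ with ∈ₚ.∈-++⁻ (elems S₁) x∈
  ... | inj₁ x∈₁ = trans (S≡∪ x) (cong (_∨ S₂ x) (∈-elems⁻ S₁ x∈₁))
  ... | inj₂ x∈₂ = trans (S≡∪ x) (trans (cong (S₁ x ∨_) (∈-elems⁻ S₂ x∈₂)) (Boolₚ.∨-zeroʳ (S₁ x)))

elems-preimage : (A : Aut n) (S : Subset n) → elems (S ∘ to A) ↭ List.map (from A) (elems S)
elems-preimage A S =
  elems-↭ (Uniqueₚ.map⁺ (from-injective A) (elems-unique S)) preimage⇒image image⇒preimage
  where
  preimage⇒image : ∀ {x} → x ∈ˢ S ∘ to A → x ∈ List.map (from A) (elems S)
  preimage⇒image {x} Sx = subst (_∈ _) (from∘to A x) (∈ₚ.∈-map⁺ (from A) (∈-elems⁺ S Sx))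
  image⇒preimage : ∀ {x} → x ∈ List.map (from A) (elems S) → x ∈ˢ S ∘ to A
  image⇒preimage x∈ with y , y∈ , refl ← ∈ₚ.∈-map⁻ (from A) x∈ =
    trans (cong S (to∘from A y)) (∈-elems⁻ S y∈)

nonempty⇒member : (S : Subset n) → 1 ≤ card S → ∃ λ x → x ∈ˢ S
nonempty⇒member S 1≤card with elems S in eq
... | x ∷ _ = x , ∈-elems⁻ S (subst (x ∈_) (sym eq) (here refl))

member⇒nonempty : (S : Subset n) {x : Pt n} → x ∈ˢ S → 1 ≤ card S
member⇒nonempty S x∈S = ∈ₚ.∈-length (∈-elems⁺ S x∈S)

-- Blocks

Block-preimage : (A : Aut n) → Block k S → Block k (S ∘ to A)
Block-preimage {S = S} A (S𝟎≡false , card≡k , sum≡𝟎) =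
  trans (cong S (linear-𝟎 (to A) (to-linear A))) S𝟎≡false ,
  trans (↭ₚ.↭-length (elems-preimage A S)) (trans (Listₚ.length-map (from A) (elems S)) card≡k) ,
  trans (∑-↭ (elems-preimage A S))
        (trans (∑-map (from A) (from-linear A) (elems S))
               (trans (cong (from A) sum≡𝟎) (linear-𝟎 (from A) (from-linear A))))

Reducible-preimage : (A : Aut n) → Reducible k S → Reducible k (S ∘ to A)
Reducible-preimage A (k₁ , k₂ , S₁ , S₂ , 1≤k₁ , 1≤k₂ , k₁+k₂≡k , S₁-block , S₂-block , disjoint , S≡∪) =
  k₁ , k₂ , S₁ ∘ to A , S₂ ∘ to A , 1≤k₁ , 1≤k₂ , k₁+k₂≡k ,
  Block-preimage A S₁-block , Block-preimage A S₂-block , disjoint ∘ to A , S≡∪ ∘ to A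

Reducible-cong : (∀ x → S x ≡ S′ x) → Reducible k S → Reducible k S′
Reducible-cong S≗S′ (k₁ , k₂ , S₁ , S₂ , 1≤k₁ , 1≤k₂ , k₁+k₂≡k , S₁-block , S₂-block , disjoint , S≡∪) =
  k₁ , k₂ , S₁ , S₂ , 1≤k₁ , 1≤k₂ , k₁+k₂≡k , S₁-block , S₂-block , disjoint ,
  λ x → trans (sym (S≗S′ x)) (S≡∪ x)

reducible-by-subblock : Block k S → (W : Subset n) → W ⊆ S → 1 ≤ card W → sumSet W ≡ 𝟎 →
                        {x : Pt n} → x ∈ˢ S → W x ≡ false → Reducible k S
reducible-by-subblock {k} {S = S} (S𝟎≡false , card≡k , sum≡𝟎) W W⊆S 1≤cardW sumW≡𝟎 {x} x∈S x∉W =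
  card W , card R , W , R , 1≤cardW , member⇒nonempty R x∈R , cards ,
  (W𝟎≡false , refl , sumW≡𝟎) , (cong (_∧ _) S𝟎≡false , refl , sumR≡𝟎) , disjoint , S≡W∪R
  where
  R : Subset _
  R y = S y ∧ not (W y)
  S≡W∪R : ∀ y → S y ≡ W y ∨ R y
  S≡W∪R y with W y in y∈W
  ... | true  = W⊆S y∈W
  ... | false = sym (Boolₚ.∧-identityʳ (S y))
  disjoint : ∀ y → W y ∧ R y ≡ false
  disjoint y with W y
  ... | true  = Boolₚ.∧-zeroʳ (S y)
  ... | false = refl
  x∈R : x ∈ˢ R
  x∈R = cong₂ _∧_ x∈S (cong not x∉W)
  W𝟎≡false : W 𝟎 ≡ false
  W𝟎≡false with W 𝟎 in 𝟎∈W
  ... | true  = trans (sym (W⊆S 𝟎∈W)) S𝟎≡false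
  ... | false = refl
  split : elems S ↭ elems W ++ elems R
  split = elems-∪ W R S≡W∪R disjoint
  cards : card W ℕ.+ card R ≡ k
  cards = trans (sym (Listₚ.length-++ (elems W))) (trans (sym (↭ₚ.↭-length split)) card≡k)
  sumR≡𝟎 : sumSet R ≡ 𝟎
  sumR≡𝟎 = begin
    sumSet R               ≡⟨ sym (⊕-identityˡ (sumSet R)) ⟩
    𝟎 ⊕ sumSet R           ≡⟨ cong (_⊕ sumSet R) (sym sumW≡𝟎) ⟩
    sumSet W ⊕ sumSet R    ≡⟨ sym (∑-++ (elems W) (elems R)) ⟩
    ∑ (elems W ++ elems R) ≡⟨ sym (∑-↭ split) ⟩
    sumSet S               ≡⟨ sum≡𝟎 ⟩
    𝟎                      ∎
    where open ≡-Reasoning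

-- The block cₖ

prefix : (m n : ℕ) → List (Fin n)
prefix m n = List.filter (λ i → toℕ i ℕₚ.<? m) (List.allFin n)

-- cList n k is definitionally basisPrefix (k ∸ 1) n ++ [ onesPrefix (k ∸ 1) n ].
basisPrefix : (m n : ℕ) → List (Pt n)
basisPrefix m n = List.map basis (prefix m n)

onesPrefix : (m n : ℕ) → Pt n
onesPrefix m n = tabulate λ j → toℕ j <ᵇ m

module _ {m : ℕ} where

  ∈-prefix⁺ : {i : Fin n} → toℕ i < m → i ∈ prefix m n
  ∈-prefix⁺ {i = i} = ∈ₚ.∈-filter⁺ (λ i → toℕ i ℕₚ.<? m) (∈ₚ.∈-allFin i)

  ∈-prefix⁻ : {i : Fin n} → i ∈ prefix m n → toℕ i < m
  ∈-prefix⁻ {n} = proj₂ ∘ ∈ₚ.∈-filter⁻ (λ i → toℕ i ℕₚ.<? m) {xs = List.allFin n}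

  prefix-unique : Unique (prefix m n)
  prefix-unique {n} = Uniqueₚ.filter⁺ (λ i → toℕ i ℕₚ.<? m) (Uniqueₚ.allFin⁺ n)

  ∈-basisPrefix⁺ : {i : Fin n} → toℕ i < m → basis i ∈ basisPrefix m n
  ∈-basisPrefix⁺ = ∈ₚ.∈-map⁺ basis ∘ ∈-prefix⁺

  ∈-basisPrefix⁻ : {x : Pt n} → x ∈ basisPrefix m n → ∃ λ i → toℕ i < m × x ≡ basis i
  ∈-basisPrefix⁻ x∈ with i , i∈ , x≡eᵢ ← ∈ₚ.∈-map⁻ basis x∈ = i , ∈-prefix⁻ i∈ , x≡eᵢ

  basisPrefix-unique : Unique (basisPrefix m n)
  basisPrefix-unique = Uniqueₚ.map⁺ basis-injective prefix-unique


lookup-onesPrefix : (m : ℕ) (j : Fin n) → lookup (onesPrefix m n) j ≡ (toℕ j <ᵇ m)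
lookup-onesPrefix m j = Vecₚ.lookup∘tabulate _ j

basisPrefix-zero : basisPrefix 0 n ≡ []
basisPrefix-zero {n} =
  cong (List.map basis) (Listₚ.filter-none (λ i → toℕ i ℕₚ.<? 0) (All.universal (λ _ ()) (List.allFin n)))

basisPrefix-suc : {m : ℕ} (p : Fin n) → toℕ p ≡ m → basisPrefix (suc m) n ↭ basis p ∷ basisPrefix m n
basisPrefix-suc {m = m} p p≡m =
  ↭-of-same-members basisPrefix-unique (All.tabulate p-new ∷ basisPrefix-unique) old⇒new new⇒old
  where
  p-new : ∀ {x} → x ∈ basisPrefix m _ → basis p ≢ x
  p-new x∈ eq with i , i<m , refl ← ∈-basisPrefix⁻ x∈ =
    ℕₚ.<-irrefl (trans (sym (cong toℕ (basis-injective eq))) p≡m) i<m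
  old⇒new : ∀ {x} → x ∈ basisPrefix (suc m) _ → x ∈ basis p ∷ basisPrefix m _
  old⇒new x∈ with i , i<1+m , refl ← ∈-basisPrefix⁻ x∈ with toℕ i ℕₚ.≟ m
  ... | yes i≡m = here (cong basis (Finₚ.toℕ-injective (trans i≡m (sym p≡m))))
  ... | no  i≢m = there (∈-basisPrefix⁺ (ℕₚ.≤∧≢⇒< (ℕₚ.≤-pred i<1+m) i≢m))
  new⇒old : ∀ {x} → x ∈ basis p ∷ basisPrefix m _ → x ∈ basisPrefix (suc m) _
  new⇒old (here refl) = ∈-basisPrefix⁺ (ℕₚ.≤-reflexive (cong suc p≡m))
  new⇒old (there x∈) with i , i<m , refl ← ∈-basisPrefix⁻ x∈ = ∈-basisPrefix⁺ (ℕₚ.m≤n⇒m≤1+n i<m)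

lookup-∑-basis-∉ : (is : List (Fin n)) {j : Fin n} → j ∉ is → lookup (∑ (List.map basis is)) j ≡ false
lookup-∑-basis-∉ []       {j} j∉ = lookup-𝟎 j
lookup-∑-basis-∉ (i ∷ is) {j} j∉ = trans (lookup-⊕ (basis i) _ j)
  (cong₂ _xor_ (lookup-basis-other (j∉ ∘ here ∘ sym)) (lookup-∑-basis-∉ is (j∉ ∘ there)))

lookup-∑-basis-∈ : {is : List (Fin n)} {j : Fin n} → Unique is → j ∈ is → lookup (∑ (List.map basis is)) j ≡ true
lookup-∑-basis-∈ {is = i ∷ is} (i∉is ∷ _) (here refl) = trans (lookup-⊕ (basis i) _ i)
  (cong₂ _xor_ (lookup-basis-same i) (lookup-∑-basis-∉ is (λ i∈is → All.lookup i∉is i∈is refl)))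
lookup-∑-basis-∈ {is = i ∷ is} {j} (i∉is ∷ is!) (there j∈is) = trans (lookup-⊕ (basis i) _ j)
  (cong₂ _xor_ (lookup-basis-other (All.lookup i∉is j∈is)) (lookup-∑-basis-∈ is! j∈is))

<ᵇ-true : {a b : ℕ} → a < b → (a <ᵇ b) ≡ true
<ᵇ-true {a} {b} = dec-true (a ℕₚ.<? b)

<ᵇ-false : {a b : ℕ} → ¬ a < b → (a <ᵇ b) ≡ false
<ᵇ-false {a} {b} = dec-false (a ℕₚ.<? b)

lookup-∑-select-basisPrefix : (m : ℕ) (p : Pt n → Bool) (j : Fin n) →
                              lookup (∑ (select p (basisPrefix m n))) j ≡ (toℕ j <ᵇ m) ∧ p (basis j)
lookup-∑-select-basisPrefix {n} m p j =
  trans (cong (λ xs → lookup (∑ xs) j) (select-map p basis (prefix m n))) by-cases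
  where
  q : Fin n → Bool
  q = p ∘ basis
  selected : List (Fin n)
  selected = select q (prefix m n)
  selected⇒ : ∀ {i} → i ∈ selected → i ∈ prefix m n × q i ≡ true
  selected⇒ = ∈-select⁻ q {xs = prefix m n}
  by-cases : lookup (∑ (List.map basis selected)) j ≡ (toℕ j <ᵇ m) ∧ q j
  by-cases with toℕ j ℕₚ.<? m | q j in qj
  ... | yes j<m | true  =
    trans (lookup-∑-basis-∈ (select-unique q prefix-unique) (∈-select⁺ q (∈-prefix⁺ j<m) qj))
          (sym (cong (_∧ true) (<ᵇ-true j<m)))
  ... | yes _   | false =
    trans (lookup-∑-basis-∉ selected λ j∈ → contradiction (trans (sym (proj₂ (selected⇒ j∈))) qj) λ ())
          (sym (Boolₚ.∧-zeroʳ (toℕ j <ᵇ m)))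
  ... | no  j≮m | qⱼ    =
    trans (lookup-∑-basis-∉ selected λ j∈ → j≮m (∈-prefix⁻ (proj₁ (selected⇒ j∈))))
          (sym (cong (_∧ qⱼ) (<ᵇ-false j≮m)))

∑-basisPrefix : (m n : ℕ) → ∑ (basisPrefix m n) ≡ onesPrefix m n
∑-basisPrefix m n = lookup-ext λ j → begin
  lookup (∑ (basisPrefix m n)) j                      ≡⟨ cong (λ xs → lookup (∑ xs) j) (sym select-all) ⟩
  lookup (∑ (select (λ _ → true) (basisPrefix m n))) j ≡⟨ lookup-∑-select-basisPrefix m (λ _ → true) j ⟩
  (toℕ j <ᵇ m) ∧ true                                 ≡⟨ Boolₚ.∧-identityʳ _ ⟩
  toℕ j <ᵇ m                                          ≡⟨ sym (lookup-onesPrefix m j) ⟩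
  lookup (onesPrefix m n) j                           ∎
  where
  open ≡-Reasoning
  select-all : select (λ _ → true) (basisPrefix m n) ≡ basisPrefix m n
  select-all = Listₚ.filter-all (λ _ → true Bool.≟ true) (All.universal (λ _ → refl) _)

onesPrefix∉basisPrefix : {m : ℕ} → 2 ≤ m → m ≤ n → onesPrefix m n ∉ basisPrefix m n
onesPrefix∉basisPrefix {zero}          (s≤s (s≤s _)) ()
onesPrefix∉basisPrefix {suc zero}      (s≤s (s≤s _)) (s≤s ())
onesPrefix∉basisPrefix {suc (suc n)} {m} 2≤m _ s∈
  with i , _ , s≡eᵢ ← ∈-basisPrefix⁻ {m = m} s∈ =
  0≢1 (trans (sym (support Fin.zero (ℕₚ.≤-trans (s≤s z≤n) 2≤m))) (support (Fin.suc Fin.zero) 2≤m))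
  where
  0≢1 : Fin.zero {suc n} ≢ Fin.suc Fin.zero
  0≢1 ()
  support : (j : Fin (suc (suc n))) → toℕ j < m → i ≡ j
  support j j<m = lookup-basis-true (trans (cong (λ v → lookup v j) (sym s≡eᵢ))
                                           (trans (lookup-onesPrefix m j) (<ᵇ-true j<m)))

cList-unique : {m : ℕ} → 2 ≤ m → m ≤ n → Unique (basisPrefix m n ++ [ onesPrefix m n ])
cList-unique 2≤m m≤n =
  Uniqueₚ.++⁺ basisPrefix-unique (All.[] ∷ []) λ where (s∈ , here refl) → onesPrefix∉basisPrefix 2≤m m≤n s∈

xor≡false⇒≡ : {a b : Bool} → a xor b ≡ false → a ≡ b
xor≡false⇒≡ {false} {false} _ = refl
xor≡false⇒≡ {true}  {true}  _ = refl

-- Coordinate i < k ∸ 1 of the sum is p(eᵢ) xor p(s): eᵢ and s = e₁ + ⋯ + eₖ₋₁ are the members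
-- of cₖ with a 1 there.
zeroSum-select-constant : (k : ℕ) (p : Pt n → Bool) → ∑ (select p (cList n k)) ≡ 𝟎 →
                          ∀ {x} → x ∈ cList n k → p x ≡ p (onesPrefix (k ∸ 1) n)
zeroSum-select-constant {n} k p sum≡𝟎 x∈c with ∈ₚ.∈-++⁻ (basisPrefix (k ∸ 1) n) x∈c
... | inj₂ (here refl) = refl
... | inj₁ x∈E with i , i<m , refl ← ∈-basisPrefix⁻ {m = k ∸ 1} x∈E = xor≡false⇒≡ (begin
  p (basis i) xor p s
    ≡⟨ cong₂ _xor_ (sym (cong (_∧ p (basis i)) (<ᵇ-true i<m))) (sym last-coordinate) ⟩
  ((toℕ i <ᵇ m) ∧ p (basis i)) xor lookup (∑ (select p [ s ])) i
    ≡⟨ cong (_xor lookup (∑ (select p [ s ])) i) (sym (lookup-∑-select-basisPrefix m p i)) ⟩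
  lookup (∑ (select p E)) i xor lookup (∑ (select p [ s ])) i
    ≡⟨ sym (lookup-⊕ (∑ (select p E)) _ i) ⟩
  lookup (∑ (select p E) ⊕ ∑ (select p [ s ])) i
    ≡⟨ cong (λ v → lookup v i) (sym (∑-++ (select p E) _)) ⟩
  lookup (∑ (select p E ++ select p [ s ])) i
    ≡⟨ cong (λ xs → lookup (∑ xs) i) (sym (select-++ p E [ s ])) ⟩
  lookup (∑ (select p (E ++ [ s ]))) i
    ≡⟨ cong (λ v → lookup v i) sum≡𝟎 ⟩
  lookup 𝟎 i
    ≡⟨ lookup-𝟎 i ⟩
  false ∎)
  where
  open ≡-Reasoning
  m : ℕ
  m = k ∸ 1
  E : List (Pt n)
  E = basisPrefix m n
  s : Pt n
  s = onesPrefix m n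
  last-coordinate : lookup (∑ (select p [ s ])) i ≡ p s
  last-coordinate with p s
  ... | true  = trans (lookup-⊕ s 𝟎 i)
                      (cong₂ _xor_ (trans (lookup-onesPrefix m i) (<ᵇ-true i<m)) (lookup-𝟎 i))
  ... | false = lookup-𝟎 i

cSet-irreducible : {k : ℕ} → 3 ≤ k → k ≤ suc n → (j : ℕ) → ¬ Reducible j (cSet n k)
cSet-irreducible {n} {k} 3≤k k≤1+n j
  (k₁ , k₂ , S₁ , S₂ , 1≤k₁ , 1≤k₂ , _ , S₁-block , S₂-block , disjoint , c≡S₁∪S₂) =
  contradiction (trans (sym (cong₂ _∧_ s∈S₁ s∈S₂)) (disjoint s)) λ ()
  where
  s : Pt n
  s = onesPrefix (k ∸ 1) n
  c! : Unique (cList n k)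
  c! = cList-unique (ℕₚ.∸-monoˡ-≤ 1 3≤k) (ℕₚ.∸-monoˡ-≤ 1 k≤1+n)
  S₁⊆c : S₁ ⊆ cSet n k
  S₁⊆c {x} x∈S₁ = trans (c≡S₁∪S₂ x) (cong (_∨ S₂ x) x∈S₁)
  S₂⊆c : S₂ ⊆ cSet n k
  S₂⊆c {x} x∈S₂ = trans (c≡S₁∪S₂ x) (trans (cong (S₁ x ∨_) x∈S₂) (Boolₚ.∨-zeroʳ (S₁ x)))
  contains-s : ∀ {i} (P : Subset n) → P ⊆ cSet n k → Block i P → 1 ≤ i → s ∈ˢ P
  contains-s P P⊆c (_ , card≡i , sum≡𝟎) 1≤i
    with x , x∈P ← nonempty⇒member P (subst (1 ≤_) (sym card≡i) 1≤i) =
    trans (sym (zeroSum-select-constant k P select-sum≡𝟎 (∈ˢ⟦⟧⁻ (cList n k) (P⊆c x∈P)))) x∈P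
    where
    select-sum≡𝟎 : ∑ (select P (cList n k)) ≡ 𝟎
    select-sum≡𝟎 = trans (sym (∑-↭ (elems-restrict c! P⊆c))) sum≡𝟎
  -- A zero-sum part of cₖ is all or nothing, so both parts contain s.
  s∈S₁ : s ∈ˢ S₁
  s∈S₁ = contains-s S₁ S₁⊆c S₁-block 1≤k₁
  s∈S₂ : s ∈ˢ S₂
  s∈S₂ = contains-s S₂ S₂⊆c S₂-block 1≤k₂

inOrbit⇒irreducible : {k : ℕ} → 3 ≤ k → k ≤ suc n → InOrbit (cSet n k) S → Irreducible k S
inOrbit⇒irreducible {n} {S} {k} 3≤k k≤1+n S∈orbit S-reducible
  with A , S≡c∘A⁻¹ ← inOrbit⇒aut S∈orbit =
  cSet-irreducible 3≤k k≤1+n k (Reducible-cong S∘A≡c (Reducible-preimage A S-reducible))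
  where
  S∘A≡c : ∀ x → S (to A x) ≡ cSet n k x
  S∘A≡c x = trans (S≡c∘A⁻¹ (to A x)) (cong (cSet n k) (from∘to A x))

-- Transvections

scale : Bool → Pt n → Pt n
scale true  w = w
scale false w = 𝟎

scale-xor : (a b : Bool) (w : Pt n) → scale (a xor b) w ≡ scale a w ⊕ scale b w
scale-xor false b     w = sym (⊕-identityˡ (scale b w))
scale-xor true  false w = sym (⊕-identityʳ w)
scale-xor true  true  w = sym (⊕-same w)

module Transvection (φ : Pt n → Bool) (φ-linear : LinearFunctional φ) (w : Pt n) (φw≡false : φ w ≡ false) where

  private
    τ : Pt n → Pt n
    τ x = x ⊕ scale (φ x) w

    τ-linear : Linear τ
    τ-linear x y = begin
      (x ⊕ y) ⊕ scale (φ (x ⊕ y)) w             ≡⟨ cong (λ c → (x ⊕ y) ⊕ scale c w) (φ-linear x y) ⟩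
      (x ⊕ y) ⊕ scale (φ x xor φ y) w           ≡⟨ cong ((x ⊕ y) ⊕_) (scale-xor (φ x) (φ y) w) ⟩
      (x ⊕ y) ⊕ (scale (φ x) w ⊕ scale (φ y) w) ≡⟨ ⊕-interchange x y _ _ ⟩
      (x ⊕ scale (φ x) w) ⊕ (y ⊕ scale (φ y) w) ∎
      where open ≡-Reasoning

    φ-scale : ∀ c → φ (scale c w) ≡ false
    φ-scale true  = φw≡false
    φ-scale false = linearFunctional-𝟎 φ φ-linear

    φ∘τ : ∀ x → φ (τ x) ≡ φ x
    φ∘τ x = trans (φ-linear x _) (trans (cong (φ x xor_) (φ-scale (φ x))) (Boolₚ.xor-identityʳ (φ x)))

    τ∘τ : ∀ x → τ (τ x) ≡ x
    τ∘τ x = begin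
      τ x ⊕ scale (φ (τ x)) w  ≡⟨ cong (λ c → τ x ⊕ scale c w) (φ∘τ x) ⟩
      (x ⊕ s) ⊕ s              ≡⟨ ⊕-assoc x s s ⟩
      x ⊕ (s ⊕ s)              ≡⟨ cong (x ⊕_) (⊕-same s) ⟩
      x ⊕ 𝟎                    ≡⟨ ⊕-identityʳ x ⟩
      x                        ∎
      where
      open ≡-Reasoning
      s : Pt n
      s = scale (φ x) w

  transvection : Aut n
  transvection = record { to = τ ; from = τ ; to-linear = τ-linear ; from∘to = τ∘τ ; to∘from = τ∘τ }

  transvection-fixes : ∀ {x} → φ x ≡ false → to transvection x ≡ x
  transvection-fixes {x} φx≡false = trans (cong (λ c → x ⊕ scale c w) φx≡false) (⊕-identityʳ x)

  transvection-shifts : ∀ {x} → φ x ≡ true → to transvection x ≡ x ⊕ w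
  transvection-shifts {x} φx≡true = cong (λ c → x ⊕ scale c w) φx≡true

coordinate-linear : (j : Fin n) → LinearFunctional (λ x → lookup x j)
coordinate-linear j x y = lookup-⊕ x y j

FixesPrefix : ℕ → Aut n → Set
FixesPrefix m A = ∀ i → toℕ i < m → to A (basis i) ≡ basis i

∘ᴬ-fixesPrefix : {m : ℕ} {A B : Aut n} → FixesPrefix m B → FixesPrefix m A → FixesPrefix m (B ∘ᴬ A)
∘ᴬ-fixesPrefix {B = B} B-fixes A-fixes i i<m = trans (cong (to B) (A-fixes i i<m)) (B-fixes i i<m)

raise-coordinate : {m : ℕ} (u : Pt n) {j p : Fin n} → m ≤ toℕ j → toℕ p ≡ m → lookup u j ≡ true →
                   Σ (Aut n) λ R → FixesPrefix m R × lookup (to R u) p ≡ true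
raise-coordinate u {j} {p} m≤j p≡m uⱼ with lookup u p in uₚ
... | true  = idᴬ , (λ _ _ → refl) , uₚ
... | false = R , fixes , raised
  where
  p≢j : p ≢ j
  p≢j refl = contradiction (trans (sym uⱼ) uₚ) λ ()
  open Transvection (λ x → lookup x j) (coordinate-linear j) (basis p) (lookup-basis-other p≢j)
  R : Aut _
  R = transvection
  fixes : FixesPrefix _ R
  fixes i i<m = transvection-fixes
    (lookup-basis-other λ i≡j → ℕₚ.<-irrefl (cong toℕ i≡j) (ℕₚ.<-≤-trans i<m m≤j))
  raised : lookup (to R u) p ≡ true
  raised = trans (cong (λ v → lookup v p) (transvection-shifts {u} uⱼ))
                 (trans (lookup-⊕ u (basis p) p) (cong₂ _xor_ uₚ (lookup-basis-same p)))

clear-to-basis : {m : ℕ} (u : Pt n) {p : Fin n} → toℕ p ≡ m → lookup u p ≡ true →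
                 Σ (Aut n) λ R → FixesPrefix m R × to R u ≡ basis p
clear-to-basis u {p} p≡m uₚ = R , fixes , cleared
  where
  w≡false : lookup (u ⊕ basis p) p ≡ false
  w≡false = trans (lookup-⊕ u (basis p) p) (cong₂ _xor_ uₚ (lookup-basis-same p))
  open Transvection (λ x → lookup x p) (coordinate-linear p) (u ⊕ basis p) w≡false
  R : Aut _
  R = transvection
  fixes : FixesPrefix _ R
  fixes i i<m = transvection-fixes
    (lookup-basis-other λ i≡p → ℕₚ.<-irrefl (trans (cong toℕ i≡p) p≡m) i<m)
  cleared : to R u ≡ basis p
  cleared = begin
    to R u                ≡⟨ transvection-shifts {u} uₚ ⟩
    u ⊕ (u ⊕ basis p)     ≡⟨ sym (⊕-assoc u u (basis p)) ⟩
    (u ⊕ u) ⊕ basis p     ≡⟨ cong (_⊕ basis p) (⊕-same u) ⟩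
    𝟎 ⊕ basis p           ≡⟨ ⊕-identityˡ (basis p) ⟩
    basis p               ∎
    where open ≡-Reasoning

move-to-basis : {m : ℕ} (u : Pt n) {j p : Fin n} → m ≤ toℕ j → toℕ p ≡ m → lookup u j ≡ true →
                Σ (Aut n) λ R → FixesPrefix m R × to R u ≡ basis p
move-to-basis u m≤j p≡m uⱼ
  with R₁ , R₁-fixes , raised ← raise-coordinate u m≤j p≡m uⱼ
  with R₂ , R₂-fixes , cleared ← clear-to-basis (to R₁ u) p≡m raised =
  R₂ ∘ᴬ R₁ , ∘ᴬ-fixesPrefix {A = R₁} {B = R₂} R₂-fixes R₁-fixes , cleared

-- Irreducible blocks lie in the orbit of cₖ

-- Over ℤ₂ this is linear independence of the set of entries.
Independent : List (Pt n) → Set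
Independent {n} ws = (W : Subset n) → W ⊆ ⟦ ws ⟧ → sumSet W ≡ 𝟎 → ∀ x → W x ≡ false

independent-tail : {v : Pt n} {ws : List (Pt n)} → Independent (v ∷ ws) → Independent ws
independent-tail {v = v} {ws} indep W W⊆ws =
  indep W λ {x} x∈W → ∈ˢ⟦⟧⁺ (v ∷ ws) (there (∈ˢ⟦⟧⁻ ws {x} (W⊆ws x∈W)))

independent⇒sum≢ : {v : Pt n} {ws : List (Pt n)} → Unique (v ∷ ws) → Independent (v ∷ ws) →
                   (p : Pt n → Bool) → ∑ (select p ws) ≢ v
independent⇒sum≢ {v = v} {ws} (v∉ws ∷ ws!) indep p sum≡v =
  contradiction (trans (sym (indep W (λ {x} → W⊆ {x}) sumW≡𝟎 v)) (∈ˢ⟦⟧⁺ chosen (here refl))) λ ()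
  where
  chosen : List (Pt _)
  chosen = v ∷ select p ws
  W : Subset _
  W = ⟦ chosen ⟧
  chosen! : Unique chosen
  chosen! = Allₚ.filter⁺ (λ x → p x Bool.≟ true) v∉ws ∷ select-unique p ws!
  W⊆ : W ⊆ ⟦ v ∷ ws ⟧
  W⊆ {x} x∈W with ∈ˢ⟦⟧⁻ chosen {x} x∈W
  ... | here refl = ∈ˢ⟦⟧⁺ (v ∷ ws) (here refl)
  ... | there x∈  = ∈ˢ⟦⟧⁺ (v ∷ ws) (there (proj₁ (∈-select⁻ p {xs = ws} x∈)))
  sumW≡𝟎 : sumSet W ≡ 𝟎
  sumW≡𝟎 = trans (∑-↭ (elems-⟦⟧ chosen!)) (trans (cong (v ⊕_) sum≡v) (⊕-same v))

∑-select-coordinates : {m : ℕ} (u : Pt n) → (∀ j → m ≤ toℕ j → lookup u j ≡ false) →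
                       ∑ (select (dot u) (basisPrefix m n)) ≡ u
∑-select-coordinates {m = m} u u-vanishes = lookup-ext λ j →
  trans (lookup-∑-select-basisPrefix m (dot u) j) (trans (cong ((toℕ j <ᵇ m) ∧_) (dot-basisʳ u j)) (by-cases j))
  where
  by-cases : ∀ j → (toℕ j <ᵇ m) ∧ lookup u j ≡ lookup u j
  by-cases j with toℕ j ℕₚ.<? m
  ... | yes j<m = cong (_∧ lookup u j) (<ᵇ-true j<m)
  ... | no  j≮m = trans (cong (_∧ lookup u j) (<ᵇ-false j≮m)) (sym (u-vanishes j (ℕₚ.≮⇒≥ j≮m)))

spanned⇒sum : {m : ℕ} (T : Aut n) {v : Pt n} {ws : List (Pt n)} →
              List.map (to T) ws ↭ basisPrefix m n → (∀ j → m ≤ toℕ j → lookup (to T v) j ≡ false) →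
              ∑ (select (dot (to T v) ∘ to T) ws) ≡ v
spanned⇒sum {n} {m} T {v} {ws} T[ws]↭E Tv-vanishes = to-injective T (begin
  to T (∑ (select (u·_ ∘ to T) ws))              ≡⟨ sym (∑-map (to T) (to-linear T) (select (u·_ ∘ to T) ws)) ⟩
  ∑ (List.map (to T) (select (u·_ ∘ to T) ws))    ≡⟨ cong ∑ (sym (select-map u·_ (to T) ws)) ⟩
  ∑ (select u·_ (List.map (to T) ws))             ≡⟨ ∑-↭ (select-↭ u·_ T[ws]↭E) ⟩
  ∑ (select u·_ (basisPrefix m n))                ≡⟨ ∑-select-coordinates (to T v) Tv-vanishes ⟩
  to T v                                          ∎)
  where
  open ≡-Reasoning
  u·_ : Pt n → Bool
  u·_ = dot (to T v)

fixesPrefix⇒map-id : {m : ℕ} {R : Aut n} → FixesPrefix m R →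
                     List.map (to R) (basisPrefix m n) ≡ basisPrefix m n
fixesPrefix⇒map-id {m = m} {R} R-fixes = Listₚ.map-id-local (All.tabulate fixed)
  where
  fixed : ∀ {x} → x ∈ basisPrefix m _ → to R x ≡ x
  fixed x∈ with i , i<m , refl ← ∈-basisPrefix⁻ {m = m} x∈ = R-fixes i i<m

extend-to-basis : (ws : List (Pt n)) → Unique ws → Independent ws → length ws ≤ n →
                  Σ (Aut n) λ T → List.map (to T) ws ↭ basisPrefix (length ws) n
extend-to-basis []       _ _ _ = idᴬ , ↭-reflexive (sym basisPrefix-zero)
extend-to-basis {n} (v ∷ ws) (v∉ws ∷ ws!) indep 1+m≤n
  with T , T[ws]↭E ← extend-to-basis ws ws! (independent-tail {v = v} {ws} indep) (ℕₚ.m+n≤o⇒n≤o 1 1+m≤n)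
  with Finₚ.any? (λ j → length ws ℕₚ.≤? toℕ j ×-dec lookup (to T v) j Bool.≟ true)
... | no none = ⊥-elim (independent⇒sum≢ (v∉ws ∷ ws!) indep _ (spanned⇒sum T T[ws]↭E Tv-vanishes))
  where
  Tv-vanishes : ∀ j → length ws ≤ toℕ j → lookup (to T v) j ≡ false
  Tv-vanishes j m≤j with lookup (to T v) j in Tvⱼ
  ... | true  = ⊥-elim (none (j , m≤j , Tvⱼ))
  ... | false = refl
... | yes (j , m≤j , Tvⱼ)
  with R , R-fixes , R[Tv]≡eₚ ← move-to-basis (to T v) m≤j (Finₚ.toℕ-fromℕ< 1+m≤n) Tvⱼ =
  R ∘ᴬ T , (begin
    to R (to T v) ∷ List.map (to R ∘ to T) ws         ≡⟨ cong₂ _∷_ R[Tv]≡eₚ (Listₚ.map-∘ ws) ⟩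
    basis p ∷ List.map (to R) (List.map (to T) ws)    ↭⟨ prep (basis p) (↭ₚ.map⁺ (to R) T[ws]↭E) ⟩
    basis p ∷ List.map (to R) (basisPrefix m n)       ≡⟨ cong (basis p ∷_) (fixesPrefix⇒map-id {R = R} R-fixes) ⟩
    basis p ∷ basisPrefix m n                         ↭⟨ ↭-sym (basisPrefix-suc p (Finₚ.toℕ-fromℕ< m<n)) ⟩
    basisPrefix (suc m) n                             ∎)
  where
  open PermutationReasoning
  m : ℕ
  m = length ws
  m<n : m < n
  m<n = 1+m≤n
  p : Fin n
  p = Fin.fromℕ< m<n

⟦elems⟧ : (S : Subset n) (y : Pt n) → S y ≡ ⟦ elems S ⟧ y
⟦elems⟧ S y = ≡true-ext (∈ˢ⟦⟧⁺ (elems S) ∘ ∈-elems⁺ S) (∈-elems⁻ S ∘ ∈ˢ⟦⟧⁻ (elems S))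

⟦⟧-↭ : {xs ys : List (Pt n)} → xs ↭ ys → (y : Pt n) → ⟦ xs ⟧ y ≡ ⟦ ys ⟧ y
⟦⟧-↭ {xs = xs} {ys} xs↭ys y = ≡true-ext
  (∈ˢ⟦⟧⁺ ys ∘ ↭ₚ.∈-resp-↭ xs↭ys ∘ ∈ˢ⟦⟧⁻ xs {y}) (∈ˢ⟦⟧⁺ xs ∘ ↭ₚ.∈-resp-↭ (↭-sym xs↭ys) ∘ ∈ˢ⟦⟧⁻ ys {y})

⟦⟧-map : (A : Aut n) (xs : List (Pt n)) (y : Pt n) → ⟦ xs ⟧ y ≡ ⟦ List.map (to A) xs ⟧ (to A y)
⟦⟧-map A xs y = ≡true-ext (∈ˢ⟦⟧⁺ (List.map (to A) xs) ∘ ∈ₚ.∈-map⁺ (to A) ∘ ∈ˢ⟦⟧⁻ xs) image⇒y∈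
  where
  image⇒y∈ : to A y ∈ˢ ⟦ List.map (to A) xs ⟧ → y ∈ˢ ⟦ xs ⟧
  image⇒y∈ Ay∈ with x , x∈xs , Ay≡Ax ← ∈ₚ.∈-map⁻ (to A) (∈ˢ⟦⟧⁻ (List.map (to A) xs) Ay∈) =
    ∈ˢ⟦⟧⁺ xs (subst (_∈ xs) (sym (to-injective A Ay≡Ax)) x∈xs)

irreducible⇒independent : {v : Pt n} {ws : List (Pt n)} → Block k S → Irreducible k S →
                          elems S ≡ v ∷ ws → Independent ws
irreducible⇒independent {S = S} {v} {ws} S-block S-irreducible elems≡ W W⊆ws W-sum≡𝟎 x with W x in x∈W
... | false = refl
... | true  = ⊥-elim (S-irreducible
                (reducible-by-subblock S-block W W⊆S (member⇒nonempty W x∈W) W-sum≡𝟎 (in-S (here refl)) v∉W))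
  where
  v∷ws! : Unique (v ∷ ws)
  v∷ws! = subst Unique elems≡ (elems-unique S)
  in-S : ∀ {y} → y ∈ v ∷ ws → y ∈ˢ S
  in-S {y} y∈ = ∈-elems⁻ S (subst (y ∈_) (sym elems≡) y∈)
  W⊆S : W ⊆ S
  W⊆S {y} y∈W = in-S (there (∈ˢ⟦⟧⁻ ws {y} (W⊆ws y∈W)))
  v∉W : W v ≡ false
  v∉W with W v in v∈W
  ... | false = refl
  ... | true  = ⊥-elim (Uniqueₚ.Unique[x∷xs]⇒x∉xs v∷ws! (∈ˢ⟦⟧⁻ ws (W⊆ws v∈W)))

-- The remaining element v is the sum of the ws, so T v = e₁ + ⋯ + eₖ₋₁.
block-onto-cSet : {v : Pt n} {ws : List (Pt n)} → Block k S → elems S ≡ v ∷ ws →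
                  (T : Aut n) → List.map (to T) ws ↭ basisPrefix (k ∸ 1) n →
                  ∀ y → S y ≡ cSet n k (to T y)
block-onto-cSet {n} {k} {S} {v} {ws} (_ , _ , sum≡𝟎) elems≡ T T[ws]↭E y = begin
  S y                                      ≡⟨ ⟦elems⟧ S y ⟩
  ⟦ elems S ⟧ y                            ≡⟨ cong (λ xs → ⟦ xs ⟧ y) elems≡ ⟩
  ⟦ v ∷ ws ⟧ y                             ≡⟨ ⟦⟧-map T (v ∷ ws) y ⟩
  ⟦ List.map (to T) (v ∷ ws) ⟧ (to T y)    ≡⟨ ⟦⟧-↭ T[S]↭c (to T y) ⟩
  cSet n k (to T y)                        ∎
  where
  open ≡-Reasoning
  m : ℕ
  m = k ∸ 1
  s : Pt n
  s = onesPrefix m n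
  v≡∑ws : v ≡ ∑ ws
  v≡∑ws = ⊕≡𝟎⇒≡ (trans (cong ∑ (sym elems≡)) sum≡𝟎)
  Tv≡s : to T v ≡ s
  Tv≡s = begin
    to T v                      ≡⟨ cong (to T) v≡∑ws ⟩
    to T (∑ ws)                 ≡⟨ sym (∑-map (to T) (to-linear T) ws) ⟩
    ∑ (List.map (to T) ws)      ≡⟨ ∑-↭ T[ws]↭E ⟩
    ∑ (basisPrefix m n)         ≡⟨ ∑-basisPrefix m n ⟩
    s                           ∎
  T[S]↭c : List.map (to T) (v ∷ ws) ↭ cList n k
  T[S]↭c = subst (_↭ cList n k) (cong (_∷ List.map (to T) ws) (sym Tv≡s))
                 (↭-trans (prep s T[ws]↭E) (↭ₚ.∷↭∷ʳ s (basisPrefix m n)))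

irreducible⇒inOrbit : {k : ℕ} → 3 ≤ k → k ≤ suc n → Block k S → Irreducible k S → InOrbit (cSet n k) S
irreducible⇒inOrbit {n} {S} {k} 3≤k k≤1+n S-block@(_ , card≡k , _) S-irreducible = split (elems S) refl
  where
  split : (xs : List (Pt n)) → elems S ≡ xs → InOrbit (cSet n k) S
  split []       elems≡[] with () ← subst (3 ≤_) (trans (sym card≡k) (cong length elems≡[])) 3≤k
  split (v ∷ ws) elems≡   = aut⇒inOrbit (T ⁻¹ᴬ) (block-onto-cSet S-block elems≡ T T[ws]↭E)
    where
    1+|ws|≡k : suc (length ws) ≡ k
    1+|ws|≡k = trans (cong length (sym elems≡)) card≡k
    ws! : Unique ws
    ws! = Uniqueₚ.drop⁺ 1 (subst Unique elems≡ (elems-unique S))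
    extension : Σ (Aut n) λ T → List.map (to T) ws ↭ basisPrefix (length ws) n
    extension = extend-to-basis ws ws! (irreducible⇒independent S-block S-irreducible elems≡)
                                (ℕₚ.≤-pred (subst (_≤ suc n) (sym 1+|ws|≡k) k≤1+n))
    T : Aut n
    T = proj₁ extension
    T[ws]↭E : List.map (to T) ws ↭ basisPrefix (k ∸ 1) n
    T[ws]↭E = subst (λ l → List.map (to T) ws ↭ basisPrefix l n) (cong (_∸ 1) 1+|ws|≡k) (proj₂ extension)

proposition15 : (n : ℕ) → 2 ≤ n → (k : ℕ) → 3 ≤ k → k ≤ suc n →
    (b : Subset n) → Block k b →
    (Irreducible k b → InOrbit (cSet n k) b) × (InOrbit (cSet n k) b → Irreducible k b)
-- The hypothesis 2 ≤ n is implied by 3 ≤ k ≤ n + 1.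
proposition15 n _ k 3≤k k≤1+n b b-block =
  irreducible⇒inOrbit 3≤k k≤1+n b-block , inOrbit⇒irreducible 3≤k k≤1+n
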